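{- Let $p$ be a prime and $M_p=2^p-1$. Then $M_p$ is either prime or an overpseudoprime to base 2.
   Context: For an odd integer $m>1$, $h(m)$ denotes the multiplicative order of 2 modulo $m$. The cyclotomic cosets of 2 modulo $m$ are the orbits of the set $\{1,2,\ldots,m-1\}$ under the map $x\mapsto 2x \bmod m$; $r(m)$ denotes the number of distinct cyclotomic cosets of 2 modulo $m$. An odd composite number $n$ is called an overpseudoprime to base 2 if $n=r(n)h(n)+1$. -}

module Defs where

open import Data.Nat using (ℕ; zero; suc; _+_; _*_; _∸_; _^_; _≤_; _<_; _≤?_; NonZero)
open import Data.Nat.DivMod using (_%_)
open import Data.Nat.Divisibility using (_∣_)
open import Data.Nat.Primality using (Composite)
open import Data.List using (List; length; filter; upTo; map)
open import Data.List.Relation.Unary.All using (All; all?)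
open import Data.Empty using (⊥)
open import Data.Product using (Σ; _×_)
open import Relation.Nullary using (¬_; Dec)
open import Relation.Binary.PropositionalEquality using (_≡_)

Odd : ℕ → Set
Odd n = ¬ (2 ∣ n)

IsOrderOf2 : (m k : ℕ) → .{{_ : NonZero m}} → Set
IsOrderOf2 m k = (1 ≤ k) × ((2 ^ k) % m ≡ 1 % m)
               × (∀ j → 1 ≤ j → j < k → ¬ ((2 ^ j) % m ≡ 1 % m))

-- The cyclotomic coset of 2 modulo m containing x is {2^j x mod m : j ≥ 0}.
-- Since this sequence is periodic with period h(m) ≤ m, the indices j < m
-- already enumerate the entire coset.  x is the (least) representative of
-- its coset iff x ≤ every element of the coset.
IsCosetMin : (m x : ℕ) → .{{_ : NonZero m}} → Set
IsCosetMin m x = All (λ j → x ≤ (2 ^ j * x) % m) (upTo m)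

isCosetMin? : (m : ℕ) → .{{_ : NonZero m}} → (x : ℕ) → Dec (IsCosetMin m x)
isCosetMin? m x = all? (λ j → x ≤? (2 ^ j * x) % m) (upTo m)

-- r(m): number of distinct cyclotomic cosets of 2 modulo m partitioning
-- {1,…,m-1}, counted via their unique minimal representatives.
r : (m : ℕ) → .{{_ : NonZero m}} → ℕ
r m = length (filter (isCosetMin? m) (map suc (upTo (m ∸ 1))))

Overpseudoprime₂ : ℕ → Set
Overpseudoprime₂ zero = ⊥
Overpseudoprime₂ n@(suc _) = Odd n × Composite n
                   × Σ ℕ (λ h → IsOrderOf2 n h × (n ≡ r n * h + 1))

{-# OPTIONS --safe #-}
module Submission where

-- Let M = 2^p − 1 with p prime, so 2^p ≡ 1 (mod M). If 2^d x ≡ x (mod M) with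
-- 0 < d < p, then also 2^p x ≡ x, and Bézout (gcd(d, p) = 1) gives 2x ≡ x, i.e. x ≡ 0.
-- For x = 1 this says that 2 has order exactly p modulo M; for x ≠ 0 it says that the
-- p residues 2^j x (j < p) are distinct, so the least element of the coset of x is
-- 2^j x for exactly one j < p. Summing the indicator "2^j x mod M is a least coset
-- element" over x < M and j < p therefore gives p + (M − 1) when summing over j first,
-- and p · (1 + r(M)) when summing over x first, because x ↦ 2^j x mod M is a
-- permutation of the residues. Hence M − 1 = r(M) · p.

open import Defs
open import Data.Nat using (ℕ; _∸_; _^_)
open import Data.Nat.Primality using (Prime)
open import Data.Sum using (_⊎_)

open import Data.Nat using (zero; suc; _+_; _*_; _≤_; _<_; z≤n; s≤s; z<s; NonZero; >-nonZero; >-nonZero⁻¹; nonTrivial⇒n>1)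
open import Data.Nat.Properties
open import Data.Nat.DivMod using (_%_; _/_; m%n<n; m<n⇒m%n≡m; m*n%n≡0; m≡m%n+[m/n]*n; %-distribˡ-*; m%n%n≡m%n; [m+n]%n≡m%n)
open import Data.Nat.Divisibility using (_∣_; m∣m*n; ∣m+n∣m⇒∣n; ∣1⇒≡1)
open import Data.Nat.Primality using (prime?; prime⇒nonZero; prime⇒nonTrivial; ¬prime⇒composite)
open import Data.Nat.Coprimality using (Coprime; coprime-Bézout; prime⇒coprime)
open import Data.Nat.GCD using (module Bézout)
open import Data.Fin using (Fin; toℕ; fromℕ<; punchIn)
open import Data.Fin.Properties using (toℕ-fromℕ<; toℕ-injective; toℕ<n; punchInᵢ≢i)
open import Data.Fin.Permutation using (Permutation; permutation; _⟨$⟩ʳ_)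
open import Data.List using (length; filter; applyUpTo; upTo)
open import Data.List.Properties using (map-applyUpTo)
open import Data.List.Relation.Unary.All as All using ()
open import Data.List.Relation.Unary.All.Properties using (all-upTo)
open import Data.List.Membership.Propositional.Properties using (∈-upTo⁺)
open import Data.List.Extrema.Nat using (argmin; argmin-all; f[argmin]≤f[xs])
open import Data.Product using (_,_; ∃-syntax; _×_)
open import Data.Sum using (inj₁; inj₂)
open import Function using (_∘_; id)
open import Relation.Nullary using (¬_; Dec; yes; no; contradiction)
open import Relation.Unary using (Pred; Decidable)
open import Relation.Binary.Definitions using (tri<; tri≈; tri>)
open import Relation.Binary.PropositionalEquality
open import Algebra.Properties.Semiring.Sum +-*-semiring
  using (sum-syntax; sum-remove; sum-cong-≗; sum-replicate-zero; ∑-comm; ∑-permute)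

open ≡-Reasoning

indicator : ∀ {a} {A : Set a} → Dec A → ℕ
indicator (yes _) = 1
indicator (no _)  = 0

indicator-yes : ∀ {a} {A : Set a} (a? : Dec A) → A → indicator a? ≡ 1
indicator-yes (yes _) _ = refl
indicator-yes (no ¬a) a = contradiction a ¬a

indicator-no : ∀ {a} {A : Set a} (a? : Dec A) → ¬ A → indicator a? ≡ 0
indicator-no (yes a) ¬a = contradiction a ¬a
indicator-no (no _)  _  = refl

∑-const : ∀ n c → ∑[ _ < n ] c ≡ n * c
∑-const zero    c = refl
∑-const (suc n) c = cong (c +_) (∑-const n c)

∑-indicator-unique : ∀ {n ℓ} {P : Pred (Fin n) ℓ} (P? : Decidable P) k → P k →
                     (∀ i → P i → i ≡ k) → ∑[ i < n ] indicator (P? i) ≡ 1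
∑-indicator-unique {suc n} P? k Pk unique = begin
  ∑[ i < suc n ] indicator (P? i)                         ≡⟨ sum-remove {i = k} (indicator ∘ P?) ⟩
  indicator (P? k) + ∑[ i < n ] indicator (P? (punch i))  ≡⟨ cong₂ _+_ (indicator-yes (P? k) Pk) rest≡0 ⟩
  1                                                       ∎
  where
  punch : Fin n → Fin (suc n)
  punch = punchIn k
  rest≡0 : ∑[ i < n ] indicator (P? (punch i)) ≡ 0
  rest≡0 = trans (sum-cong-≗ {n} (λ i → indicator-no (P? (punch i)) (punchInᵢ≢i k i ∘ unique (punch i))))
                 (sum-replicate-zero n)

length-filter-applyUpTo : ∀ {a ℓ} {A : Set a} {P : Pred A ℓ} (P? : Decidable P) (f : ℕ → A) n →
                          length (filter P? (applyUpTo f n)) ≡ ∑[ i < n ] indicator (P? (f (toℕ i)))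
length-filter-applyUpTo P? f zero = refl
length-filter-applyUpTo P? f (suc n) with P? (f 0)
... | yes _ = cong suc (length-filter-applyUpTo P? (f ∘ suc) n)
... | no  _ = length-filter-applyUpTo P? (f ∘ suc) n

n<2^n : ∀ n → n < 2 ^ n
n<2^n zero    = z<s
n<2^n (suc n) = subst (_< 2 ^ suc n) (+-comm n 1)
                  (+-mono-<-≤ (n<2^n n) (≤-trans (m^n>0 2 n) (m≤m+n (2 ^ n) 0)))

2^n∸1-odd : ∀ n → .{{NonZero n}} → Odd (2 ^ n ∸ 1)
2^n∸1-odd (suc n) 2∣2^n∸1 = contradiction (∣1⇒≡1 (∣m+n∣m⇒∣n 2∣2^n∸1+1 2∣2^n∸1)) λ ()
  where
  2∣2^n∸1+1 : 2 ∣ 2 ^ suc n ∸ 1 + 1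
  2∣2^n∸1+1 = subst (2 ∣_) (sym (m∸n+n≡m (m^n>0 2 (suc n)))) (m∣m*n (2 ^ n))

m*[n%d]%d≡m*n%d : ∀ m n d .{{_ : NonZero d}} → m * (n % d) % d ≡ m * n % d
m*[n%d]%d≡m*n%d m n d = begin
  m * (n % d) % d             ≡⟨ %-distribˡ-* m (n % d) d ⟩
  (m % d) * (n % d % d) % d   ≡⟨ cong (λ k → (m % d) * k % d) (m%n%n≡m%n n d) ⟩
  (m % d) * (n % d) % d       ≡⟨ %-distribˡ-* m n d ⟨
  m * n % d                   ∎

[m%d]*n%d≡m*n%d : ∀ m n d .{{_ : NonZero d}} → (m % d) * n % d ≡ m * n % d
[m%d]*n%d≡m*n%d m n d = begin
  (m % d) * n % d  ≡⟨ cong (_% d) (*-comm (m % d) n) ⟩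
  n * (m % d) % d  ≡⟨ m*[n%d]%d≡m*n%d n m d ⟩
  n * m % d        ≡⟨ cong (_% d) (*-comm n m) ⟩
  m * n % d        ∎

module Doubling (m : ℕ) .{{_ : NonZero m}} where

  double^ : ℕ → ℕ → ℕ
  double^ j x = 2 ^ j * x % m

  double^-< : ∀ j x → double^ j x < m
  double^-< j x = m%n<n (2 ^ j * x) m

  double^-0 : ∀ {x} → x < m → double^ 0 x ≡ x
  double^-0 {x} x<m = trans (cong (_% m) (*-identityˡ x)) (m<n⇒m%n≡m x<m)

  double^-zero : ∀ j → double^ j 0 ≡ 0
  double^-zero j = trans (cong (_% m) (*-zeroʳ (2 ^ j))) (m<n⇒m%n≡m (>-nonZero⁻¹ m))

  double^-% : ∀ j x → double^ j (x % m) ≡ double^ j x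
  double^-% j x = m*[n%d]%d≡m*n%d (2 ^ j) x m

  double^-+ : ∀ i j x → double^ (i + j) x ≡ double^ i (double^ j x)
  double^-+ i j x = begin
    2 ^ (i + j) * x % m      ≡⟨ cong (λ k → k * x % m) (^-distribˡ-+-* 2 i j) ⟩
    2 ^ i * 2 ^ j * x % m    ≡⟨ cong (_% m) (*-assoc (2 ^ i) (2 ^ j) x) ⟩
    2 ^ i * (2 ^ j * x) % m  ≡⟨ double^-% i (2 ^ j * x) ⟨
    double^ i (double^ j x)  ∎

  Fixed : ℕ → ℕ → Set
  Fixed d y = double^ d y ≡ y

  Fixed⇒< : ∀ {d y} → Fixed d y → y < m
  Fixed⇒< {d} {y} fix = subst (_< m) fix (double^-< d y)

  Fixed-+ : ∀ {a b y} → Fixed a y → Fixed b y → Fixed (a + b) y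
  Fixed-+ {a} {b} {y} fix-a fix-b = trans (double^-+ a b y) (trans (cong (double^ a) fix-b) fix-a)

  Fixed-* : ∀ {a y} → y < m → Fixed a y → ∀ k → Fixed (k * a) y
  Fixed-* y<m fix zero    = double^-0 y<m
  Fixed-* {a} y<m fix (suc k) = Fixed-+ {a} {k * a} fix (Fixed-* y<m fix k)

  Fixed-cancelʳ : ∀ {a b y} → Fixed b y → Fixed (a + b) y → Fixed a y
  Fixed-cancelʳ {a} {b} {y} fix-b fix-ab =
    trans (cong (double^ a) (sym fix-b)) (trans (sym (double^-+ a b y)) fix-ab)

  Fixed-coprime : ∀ {a b y} → Coprime a b → Fixed a y → Fixed b y → Fixed 1 y
  Fixed-coprime {a} {b} {y} a⊥b fix-a fix-b with coprime-Bézout a⊥b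
  ... | Bézout.+- u v 1+vb≡ua = Fixed-cancelʳ {1} {v * b}
    (Fixed-* {b} y<m fix-b v) (subst (λ d → Fixed d y) (sym 1+vb≡ua) (Fixed-* {a} y<m fix-a u))
    where y<m = Fixed⇒< {a} fix-a
  ... | Bézout.-+ u v 1+ua≡vb = Fixed-cancelʳ {1} {u * a}
    (Fixed-* {a} y<m fix-a u) (subst (λ d → Fixed d y) (sym 1+ua≡vb) (Fixed-* {b} y<m fix-b v))
    where y<m = Fixed⇒< {a} fix-a

  Fixed-1⇒≡0 : ∀ {y} → Fixed 1 y → y ≡ 0
  Fixed-1⇒≡0 {y} fix = begin
    y          ≡⟨ m<n⇒m%n≡m (Fixed⇒< {1} fix) ⟨
    y % m      ≡⟨ cong (_% m) y≡q*m ⟩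
    q * m % m  ≡⟨ m*n%n≡0 q m ⟩
    0          ∎
    where
    q = 2 * y / m
    y≡q*m : y ≡ q * m
    y≡q*m = +-cancelˡ-≡ y y (q * m) (begin
      y + y              ≡⟨ cong (y +_) (+-identityʳ y) ⟨
      2 * y              ≡⟨ m≡m%n+[m/n]*n (2 * y) m ⟩
      2 * y % m + q * m  ≡⟨ cong (_+ q * m) fix ⟩
      y + q * m          ∎)

  cosetMin⁺ : ∀ {x} → (∀ j → x ≤ double^ j x) → IsCosetMin m x
  cosetMin⁺ least = All.tabulate (λ {j} _ → least j)

  cosetMin-0 : IsCosetMin m 0
  cosetMin-0 = cosetMin⁺ (λ _ → z≤n)

module PrimePeriod {n p : ℕ} (p-prime : Prime p) (2^p≡1 : 2 ^ p % suc n ≡ 1 % suc n)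
                  (p≤m : p ≤ suc n) where

  m : ℕ
  m = suc n

  open Doubling m

  instance
    _ : NonZero p
    _ = prime⇒nonZero p-prime

  double^-p : ∀ x → double^ p x ≡ x % m
  double^-p x = begin
    2 ^ p * x % m      ≡⟨ [m%d]*n%d≡m*n%d (2 ^ p) x m ⟨
    2 ^ p % m * x % m  ≡⟨ cong (λ k → k * x % m) 2^p≡1 ⟩
    1 % m * x % m      ≡⟨ [m%d]*n%d≡m*n%d 1 x m ⟩
    1 * x % m          ≡⟨ cong (_% m) (*-identityˡ x) ⟩
    x % m              ∎

  Fixed-p : ∀ {y} → y < m → Fixed p y
  Fixed-p {y} y<m = trans (double^-p y) (m<n⇒m%n≡m y<m)

  double^-%p : ∀ j x → double^ j x ≡ double^ (j % p) x
  double^-%p j x = begin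
    double^ j x                                    ≡⟨ cong (λ i → double^ i x) (m≡m%n+[m/n]*n j p) ⟩
    double^ (j % p + j / p * p) x                  ≡⟨ double^-+ (j % p) (j / p * p) x ⟩
    double^ (j % p) (double^ (j / p * p) x)        ≡⟨ cong (double^ (j % p)) (double^-% (j / p * p) x) ⟨
    double^ (j % p) (double^ (j / p * p) (x % m))  ≡⟨ cong (double^ (j % p)) (Fixed-* x%m<m (Fixed-p x%m<m) (j / p)) ⟩
    double^ (j % p) (x % m)                        ≡⟨ double^-% (j % p) x ⟩
    double^ (j % p) x                              ∎
    where x%m<m = m%n<n x m

  double^-inverse : ∀ i j {x} → i + j ≡ p → x < m → double^ i (double^ j x) ≡ x
  double^-inverse i j {x} i+j≡p x<m =
    trans (sym (double^-+ i j x)) (subst (λ d → Fixed d x) (sym i+j≡p) (Fixed-p x<m))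

  Fixed⇒≡0 : ∀ {d y} → 0 < d → d < p → Fixed d y → y ≡ 0
  Fixed⇒≡0 {d} 0<d d<p fix = Fixed-1⇒≡0
    (Fixed-coprime (prime⇒coprime p-prime {{>-nonZero 0<d}} d<p) (Fixed-p (Fixed⇒< {d} fix)) fix)

  order : 1 < m → IsOrderOf2 m p
  order 1<m = >-nonZero⁻¹ p , 2^p≡1 , λ j 0<j j<p 2^j≡1 → 1+n≢0 (Fixed⇒≡0 0<j j<p (fixes-1 j 2^j≡1))
    where
    fixes-1 : ∀ j → 2 ^ j % m ≡ 1 % m → Fixed j 1
    fixes-1 j 2^j≡1 = trans (cong (_% m) (*-identityʳ (2 ^ j))) (trans 2^j≡1 (m<n⇒m%n≡m 1<m))

  -- IsCosetMin only inspects the exponents below m; periodicity extends it to all of them.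
  cosetMin⁻ : ∀ {x} → IsCosetMin m x → ∀ j → x ≤ double^ j x
  cosetMin⁻ {x} min j = subst (x ≤_) (sym (double^-%p j x))
    (All.lookup min (∈-upTo⁺ (<-≤-trans (m%n<n j p) p≤m)))

  cosetMin-exists : ∀ x → ∃[ j ] j < p × IsCosetMin m (double^ j x)
  cosetMin-exists x = j₀ , j₀<p , cosetMin⁺ least
    where
    orbit : ℕ → ℕ
    orbit j = double^ j x
    j₀ = argmin orbit 0 (upTo p)
    j₀<p : j₀ < p
    j₀<p = argmin-all orbit (>-nonZero⁻¹ p) (all-upTo p)
    least : ∀ k → orbit j₀ ≤ double^ k (orbit j₀)
    least k = subst (orbit j₀ ≤_) (trans (sym (double^-%p (k + j₀) x)) (double^-+ k j₀ x))
      (All.lookup (f[argmin]≤f[xs] {f = orbit} 0 (upTo p)) (∈-upTo⁺ (m%n<n (k + j₀) p)))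

  cosetMin-orbit-unique : ∀ {y k} → y < m → k ≤ p →
                          IsCosetMin m y → IsCosetMin m (double^ k y) → Fixed k y
  cosetMin-orbit-unique {y} {k} y<m k≤p min-y min-ky = ≤-antisym
    (subst (double^ k y ≤_) (double^-inverse (p ∸ k) k (m∸n+n≡m k≤p) y<m) (cosetMin⁻ min-ky (p ∸ k)))
    (cosetMin⁻ min-y k)

  cosetMin-twice⇒≡0 : ∀ {x i j} → x < m → i < j → j < p →
                      IsCosetMin m (double^ i x) → IsCosetMin m (double^ j x) → x ≡ 0
  cosetMin-twice⇒≡0 {x} {i} {j} x<m i<j j<p min-i min-j = begin
    x                              ≡⟨ double^-inverse (p ∸ i) i (m∸n+n≡m (<⇒≤ (<-trans i<j j<p))) x<m ⟨
    double^ (p ∸ i) (double^ i x)  ≡⟨ cong (double^ (p ∸ i)) y≡0 ⟩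
    double^ (p ∸ i) 0              ≡⟨ double^-zero (p ∸ i) ⟩
    0                              ∎
    where
    y = double^ i x
    k = j ∸ i
    ky≡jx : double^ k y ≡ double^ j x
    ky≡jx = trans (sym (double^-+ k i x)) (cong (λ d → double^ d x) (m∸n+n≡m (<⇒≤ i<j)))
    y≡0 : y ≡ 0
    y≡0 = Fixed⇒≡0 (m<n⇒0<n∸m i<j) (≤-<-trans (m∸n≤m j i) j<p)
      (cosetMin-orbit-unique (double^-< i x) (≤-trans (m∸n≤m j i) (<⇒≤ j<p))
                             min-i (subst (λ z → IsCosetMin m z) (sym ky≡jx) min-j))

  cosetMin-index-unique : ∀ {x i j} → 0 < x → x < m → i < p → j < p →
                          IsCosetMin m (double^ i x) → IsCosetMin m (double^ j x) → i ≡ j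
  cosetMin-index-unique {i = i} {j} 0<x x<m i<p j<p min-i min-j with <-cmp i j
  ... | tri< i<j _ _ = contradiction (cosetMin-twice⇒≡0 x<m i<j j<p min-i min-j) (>⇒≢ 0<x)
  ... | tri≈ _ i≡j _ = i≡j
  ... | tri> _ _ j<i = contradiction (cosetMin-twice⇒≡0 x<m j<i i<p min-j min-i) (>⇒≢ 0<x)

  χ : ℕ → ℕ
  χ y = indicator (isCosetMin? m y)

  minima-in-orbit : ℕ → ℕ
  minima-in-orbit x = ∑[ j < p ] χ (double^ (toℕ j) x)

  minima-in-orbit-0 : minima-in-orbit 0 ≡ p
  minima-in-orbit-0 = begin
    ∑[ j < p ] χ (double^ (toℕ j) 0)  ≡⟨ sum-cong-≗ {p} (λ j → trans (cong χ (double^-zero (toℕ j))) χ0≡1) ⟩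
    ∑[ j < p ] 1                      ≡⟨ ∑-const p 1 ⟩
    p * 1                             ≡⟨ *-identityʳ p ⟩
    p                                 ∎
    where χ0≡1 = indicator-yes (isCosetMin? m 0) cosetMin-0

  minima-in-orbit-nonzero : ∀ {x} → 0 < x → x < m → minima-in-orbit x ≡ 1
  minima-in-orbit-nonzero {x} 0<x x<m =
    let j₀ , j₀<p , min-j₀ = cosetMin-exists x in
    ∑-indicator-unique {p} (λ j → isCosetMin? m (double^ (toℕ j) x))
      (fromℕ< j₀<p) (subst (λ j → IsCosetMin m (double^ j x)) (sym (toℕ-fromℕ< j₀<p)) min-j₀)
      (λ i min-i → toℕ-injective (trans (cosetMin-index-unique 0<x x<m (toℕ<n i) j₀<p min-i min-j₀)
                                        (sym (toℕ-fromℕ< j₀<p))))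

  double^-permutation : ∀ {j} → j ≤ p → Permutation m m
  double^-permutation {j} j≤p = permutation (rotate j) (rotate (p ∸ j))
    (λ y → toℕ-injective (inverse j (p ∸ j) (m+[n∸m]≡n j≤p) y))
    (λ x → toℕ-injective (inverse (p ∸ j) j (m∸n+n≡m j≤p) x))
    where
    rotate : ℕ → Fin m → Fin m
    rotate i x = fromℕ< (double^-< i (toℕ x))
    toℕ-rotate : ∀ i x → toℕ (rotate i x) ≡ double^ i (toℕ x)
    toℕ-rotate i x = toℕ-fromℕ< (double^-< i (toℕ x))
    inverse : ∀ i k → i + k ≡ p → ∀ x → toℕ (rotate i (rotate k x)) ≡ toℕ x
    inverse i k i+k≡p x = begin
      toℕ (rotate i (rotate k x))     ≡⟨ toℕ-rotate i (rotate k x) ⟩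
      double^ i (toℕ (rotate k x))    ≡⟨ cong (double^ i) (toℕ-rotate k x) ⟩
      double^ i (double^ k (toℕ x))   ≡⟨ double^-inverse i k i+k≡p (toℕ<n x) ⟩
      toℕ x                           ∎

  ∑-χ-double^ : ∀ {j} → j ≤ p → ∑[ x < m ] χ (double^ j (toℕ x)) ≡ ∑[ x < m ] χ (toℕ x)
  ∑-χ-double^ {j} j≤p = begin
    ∑[ x < m ] χ (double^ j (toℕ x))  ≡⟨ sum-cong-≗ {m} (λ x → cong χ (toℕ-fromℕ< (double^-< j (toℕ x)))) ⟨
    ∑[ x < m ] χ (toℕ (π ⟨$⟩ʳ x))     ≡⟨ ∑-permute {m} {m} (χ ∘ toℕ) π ⟨
    ∑[ x < m ] χ (toℕ x)              ∎
    where π = double^-permutation j≤p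

  ∑-χ : ∑[ x < m ] χ (toℕ x) ≡ suc (r m)
  ∑-χ = cong₂ _+_ (indicator-yes (isCosetMin? m 0) cosetMin-0) (sym (begin
    r m                                                 ≡⟨ cong (length ∘ filter (isCosetMin? m)) (map-applyUpTo id suc n) ⟩
    length (filter (isCosetMin? m) (applyUpTo suc n))   ≡⟨ length-filter-applyUpTo (isCosetMin? m) suc n ⟩
    ∑[ i < n ] χ (suc (toℕ i))                          ∎))

  n≡r*p : n ≡ r m * p
  n≡r*p = trans (+-cancelˡ-≡ p n (p * r m) (begin
    p + n                                               ≡⟨ cong₂ _+_ minima-in-orbit-0 nonzero ⟨
    ∑[ x < m ] minima-in-orbit (toℕ x)                  ≡⟨ ∑-comm {m} {p} (λ x j → χ (double^ (toℕ j) (toℕ x))) ⟩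
    ∑[ j < p ] ∑[ x < m ] χ (double^ (toℕ j) (toℕ x))  ≡⟨ sum-cong-≗ {p} (λ j → trans (∑-χ-double^ (<⇒≤ (toℕ<n j))) ∑-χ) ⟩
    ∑[ j < p ] suc (r m)                                ≡⟨ ∑-const p (suc (r m)) ⟩
    p * suc (r m)                                       ≡⟨ *-suc p (r m) ⟩
    p + p * r m                                         ∎)) (*-comm p (r m))
    where
    nonzero : ∑[ i < n ] minima-in-orbit (suc (toℕ i)) ≡ n
    nonzero = trans (sum-cong-≗ {n} (λ i → minima-in-orbit-nonzero z<s (s≤s (toℕ<n i))))
                    (trans (∑-const n 1) (*-identityʳ n))

  m≡r*p+1 : m ≡ r m * p + 1
  m≡r*p+1 = trans (cong suc n≡r*p) (+-comm 1 (r m * p))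

mersenne-overpseudoprime : ∀ {p} → Prime p → ¬ Prime (2 ^ p ∸ 1) → Overpseudoprime₂ (2 ^ p ∸ 1)
mersenne-overpseudoprime {p} p-prime ¬prime =
  subst Overpseudoprime₂ (sym M≡2+k)
    ( subst Odd M≡2+k (2^n∸1-odd p {{prime⇒nonZero p-prime}})
    , ¬prime⇒composite (¬prime ∘ subst Prime (sym M≡2+k))
    , p , order (s≤s (s≤s z≤n)) , m≡r*p+1 )
  where
  3≤2^p : 3 ≤ 2 ^ p
  3≤2^p = ≤-<-trans (nonTrivial⇒n>1 p {{prime⇒nonTrivial p-prime}}) (n<2^n p)
  k = 2 ^ p ∸ 3
  2^p≡3+k : 2 ^ p ≡ 3 + k
  2^p≡3+k = sym (m+[n∸m]≡n 3≤2^p)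
  M≡2+k : 2 ^ p ∸ 1 ≡ 2 + k
  M≡2+k = cong (_∸ 1) 2^p≡3+k
  open PrimePeriod {suc k} p-prime (trans (cong (_% (2 + k)) 2^p≡3+k) ([m+n]%n≡m%n 1 (2 + k)))
                  (≤-pred (subst (p <_) 2^p≡3+k (n<2^n p)))

corollary2 : (p : ℕ) → Prime p →
    Prime (2 ^ p ∸ 1) ⊎ Overpseudoprime₂ (2 ^ p ∸ 1)
corollary2 p p-prime with prime? (2 ^ p ∸ 1)
... | yes M-prime = inj₁ M-prime
... | no ¬M-prime = inj₂ (mersenne-overpseudoprime p-prime ¬M-prime)
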